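{- Let $G$ be a 3-connected graph and let $(A,B)$ be a mixed 3-separation of $G$ such that both $G[A]$ and $G[B]$ contain a cycle. Then the edges in the separator of $(A,B)$ form a matching between $A\setminus B$ and $B\setminus A$.
   Context: A mixed 3-separation of $G$ is an ordered pair $(A,B)$ with $A\cup B=V(G)$, $A\setminus B$ and $B\setminus A$ nonempty, whose separator, the disjoint union of the vertex set $A\cap B$ and the edge set $E(A\setminus B,B\setminus A)$, has size three. -}

module Defs where

open import Data.Nat using (ℕ; zero; suc; _+_; _<_)
open import Data.Bool using (Bool; true; false; if_then_else_)
open import Data.Fin using (Fin; zero; suc; inject₁; fromℕ)
open import Data.Fin.Subset using (Subset; _∈_; _∉_; _∪_; _∩_; _─_; ∣_∣; ⊤; Nonempty)
open import Data.Fin.Subset.Properties using (_∈?_)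
open import Data.List using (List; allFin; map)
open import Data.Nat.ListAction using (sum)
open import Data.Product using (Σ; _×_; _,_)
open import Data.Sum using (_⊎_)
open import Function.Definitions using (Injective)
open import Relation.Nullary using (¬_; does)
open import Relation.Binary.PropositionalEquality using (_≡_)

record Graph (n : ℕ) : Set where
  field
    adj   : Fin n → Fin n → Bool
    sym   : ∀ u v → adj u v ≡ adj v u
    irrefl : ∀ u → adj u u ≡ false

open Graph public

Adj : ∀ {n} → Graph n → Fin n → Fin n → Set
Adj G u v = adj G u v ≡ true

countFin : ∀ {n} → (Fin n → Bool) → ℕ
countFin {n} p = sum (map (λ i → if p i then 1 else 0) (allFin n))

data Reach {n} (G : Graph n) (P : Fin n → Set) : Fin n → Fin n → Set where
  here : ∀ {u} → P u → Reach G P u u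
  step : ∀ {u w v} → P u → Adj G u w → Reach G P w v → Reach G P u v

KConnected : ∀ {n} → ℕ → Graph n → Set
KConnected {n} k G =
  (k < n) ×
  (∀ (X : Subset n) → ∣ X ∣ < k →
     ∀ u v → u ∉ X → v ∉ X → Reach G (λ w → w ∉ X) u v)

-- The edge set E(S, T): ordered pairs (u , v) with u ∈ S, v ∈ T, uv ∈ E(G).
-- (When S and T are disjoint, each such edge is counted exactly once.)
numEdgesBetween : ∀ {n} → Graph n → Subset n → Subset n → ℕ
numEdgesBetween {n} G S T =
  sum (map (λ u → if does (u ∈? S)
                   then countFin (λ v → if does (v ∈? T) then adj G u v else false)
                   else 0)
           (allFin n))

separatorSize : ∀ {n} → Graph n → Subset n → Subset n → ℕ
separatorSize G A B = ∣ A ∩ B ∣ + numEdgesBetween G (A ─ B) (B ─ A)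

IsMixed3Separation : ∀ {n} → Graph n → Subset n → Subset n → Set
IsMixed3Separation G A B =
  (A ∪ B ≡ ⊤) × Nonempty (A ─ B) × Nonempty (B ─ A) × (separatorSize G A B ≡ 3)

HasCycleIn : ∀ {n} → Graph n → Subset n → Set
HasCycleIn {n} G S =
  Σ ℕ λ m → Σ (Fin (suc (suc (suc m))) → Fin n) λ c →
    Injective _≡_ _≡_ c ×
    (∀ i → c i ∈ S) ×
    (∀ (i : Fin (suc (suc m))) → Adj G (c (inject₁ i)) (c (suc i))) ×
    Adj G (c (fromℕ (suc (suc m)))) (c zero)

IsMatchingBetween : ∀ {n} → Graph n → Subset n → Subset n → Set
IsMatchingBetween G S T =
  ∀ u v u' v' → u ∈ S → v ∈ T → Adj G u v → u' ∈ S → v' ∈ T → Adj G u' v' →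
    (u ≡ u' ⊎ v ≡ v') → (u ≡ u' × v ≡ v')

module Submission where

-- Suppose u ∈ A ∖ B had two neighbours in B ∖ A.  Let X be A ∩ B together with the
-- ends in A ∖ B of the separator edges.  Charging each vertex of A ∩ B once and each
-- separator edge to its end in A ∖ B shows |X| ≤ 3, and strictly, since u carries two
-- charges; so |X| ≤ 2.  The cycle in G[A] has at least three vertices, so one of them, w,
-- avoids X and therefore lies in A ∖ B.  By 3-connectivity G − X has a path from w to a
-- neighbour of u in B ∖ A.  Its first edge leaving A ∖ B either enters A ∩ B ⊆ X or is a
-- separator edge with an end in X, a contradiction.  A vertex of B ∖ A with two
-- neighbours in A ∖ B is excluded symmetrically, using the cycle in G[B].

open import Defs hiding (sym)
import Algebra.Properties.CommutativeMonoid.Sum as Sum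
open import Data.Bool using (Bool; true; false; if_then_else_)
open import Data.Bool.Properties using (if-swap-then)
open import Data.Empty using (⊥-elim)
open import Data.Fin using (Fin; zero; suc; punchIn; punchOut; _≟_)
open import Data.Fin.Properties using (0≢1+n; suc-injective; punchOut-injective; punchIn-punchOut; ¬∀⟶∃¬)
open import Data.Fin.Subset using (Subset; _∈_; _∉_; _∩_; _∪_; _─_; ∣_∣; ⊤; inside; outside)
open import Data.Fin.Subset.Properties
  using (_∈?_; x∈p∩q⁺; x∈p∩q⁻; x∈p∪q⁻; x∈p∧x∉q⇒x∈p─q; p─q⊆p; ∈⊤; ∩-comm; ∪-comm)
open import Data.List using (allFin; map; tabulate)
open import Data.List.Properties using (map-tabulate)
import Data.Nat.ListAction as List
open import Data.Nat using (ℕ; zero; suc; _+_; _≤_; _<_; z≤n; s≤s; _<?_)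
open import Data.Nat.Properties
  using (+-0-commutativeMonoid; ≤-reflexive; ≤-trans; <-≤-trans; +-mono-≤; +-mono-<-≤;
         m≤m+n; m≤n+m; <⇒≱; module ≤-Reasoning)
open import Data.Product using (∃; ∃₂; _×_; _,_; proj₁; proj₂)
open import Data.Sum using (_⊎_; inj₁; inj₂; [_,_])
open import Data.Vec using ([]; _∷_)
import Data.Vec as Vec
open import Data.Vec.Functional using (removeAt)
open import Data.Vec.Properties using ([]=⇒lookup; lookup⇒[]=; lookup∘tabulate)
open import Function using (_∘_)
open import Function.Definitions using (Injective)
open import Relation.Nullary using (¬_; Dec; yes; no; does; contradiction)
open import Relation.Nullary.Decidable using (dec-true; dec-false)
open import Relation.Unary using (Decidable)
open import Relation.Binary.PropositionalEquality
  using (_≡_; _≢_; refl; sym; trans; cong; cong₂; subst; module ≡-Reasoning)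

open Sum +-0-commutativeMonoid
  using (sum-syntax; sum-remove; sum-cong-≗; sum-replicate-zero; ∑-distrib-+; ∑-comm)
  renaming (sum to ∑)

𝟙 : Bool → ℕ
𝟙 b = if b then 1 else 0

sum-tabulate : ∀ {n} (g : Fin n → ℕ) → List.sum (tabulate g) ≡ ∑ g
sum-tabulate {zero} g = refl
sum-tabulate {suc n} g = cong (g zero +_) (sum-tabulate (g ∘ suc))

sum-map-allFin : ∀ {n} (g : Fin n → ℕ) → List.sum (map g (allFin n)) ≡ ∑ g
sum-map-allFin g = trans (cong List.sum (map-tabulate (λ i → i) g)) (sum-tabulate g)

∑-mono-≤ : ∀ {n} {f g : Fin n → ℕ} → (∀ i → f i ≤ g i) → ∑ f ≤ ∑ g
∑-mono-≤ {zero} f≤g = z≤n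
∑-mono-≤ {suc n} f≤g = +-mono-≤ (f≤g zero) (∑-mono-≤ (f≤g ∘ suc))

∑-mono-< : ∀ {n} {f g : Fin n → ℕ} → (∀ i → f i ≤ g i) → ∀ a → f a < g a → ∑ f < ∑ g
∑-mono-< {suc n} {f} {g} f≤g a fa<ga = begin-strict
  ∑ f                      ≡⟨ sum-remove {i = a} f ⟩
  f a + ∑ (removeAt f a)   <⟨ +-mono-<-≤ fa<ga (∑-mono-≤ (f≤g ∘ punchIn a)) ⟩
  g a + ∑ (removeAt g a)   ≡⟨ sym (sum-remove {i = a} g) ⟩
  ∑ g                      ∎
  where open ≤-Reasoning

≤-∑ : ∀ {n} (g : Fin n → ℕ) i → g i ≤ ∑ g
≤-∑ {suc n} g i = ≤-trans (m≤m+n (g i) _) (≤-reflexive (sym (sum-remove {i = i} g)))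

injection≤∑ : ∀ {k n} (f : Fin k → Fin n) → Injective _≡_ _≡_ f →
  (g : Fin n → ℕ) → (∀ i → 0 < g (f i)) → k ≤ ∑ g
injection≤∑ {zero} f f-inj g g∘f>0 = z≤n
injection≤∑ {suc k} {zero} f f-inj g g∘f>0 with f zero
... | ()
injection≤∑ {suc k} {suc n} f f-inj g g∘f>0 = begin
  suc k                  ≤⟨ +-mono-≤ (g∘f>0 zero) (injection≤∑ f′ f′-inj (removeAt g a) g∘f′>0) ⟩
  g a + ∑ (removeAt g a) ≡⟨ sym (sum-remove {i = a} g) ⟩
  ∑ g                    ∎
  where
  open ≤-Reasoning
  a = f zero
  a≢f[1+i] : ∀ i → a ≢ f (suc i)
  a≢f[1+i] i = 0≢1+n ∘ f-inj
  f′ : Fin k → Fin n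
  f′ i = punchOut (a≢f[1+i] i)
  f′-inj : Injective _≡_ _≡_ f′
  f′-inj {i} {j} eq = suc-injective (f-inj (punchOut-injective (a≢f[1+i] i) (a≢f[1+i] j) eq))
  g∘f′>0 : ∀ i → 0 < removeAt g a (f′ i)
  g∘f′>0 i = subst (λ x → 0 < g x) (sym (punchIn-punchOut (a≢f[1+i] i))) (g∘f>0 (suc i))

two≤∑ : ∀ {n} (g : Fin n → ℕ) {a b} → a ≢ b → 0 < g a → 0 < g b → 2 ≤ ∑ g
two≤∑ {n} g {a} {b} a≢b g[a]>0 g[b]>0 = injection≤∑ pair pair-injective g g∘pair>0
  where
  pair : Fin 2 → Fin n
  pair zero = a
  pair (suc zero) = b
  pair-injective : Injective _≡_ _≡_ pair
  pair-injective {zero} {zero} _ = refl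
  pair-injective {zero} {suc zero} a≡b = contradiction a≡b a≢b
  pair-injective {suc zero} {zero} b≡a = contradiction (sym b≡a) a≢b
  pair-injective {suc zero} {suc zero} _ = refl
  g∘pair>0 : ∀ i → 0 < g (pair i)
  g∘pair>0 zero = g[a]>0
  g∘pair>0 (suc zero) = g[b]>0

∣p∣≡∑ : ∀ {n} (p : Subset n) → ∣ p ∣ ≡ ∑[ i < n ] 𝟙 (does (i ∈? p))
∣p∣≡∑ [] = refl
∣p∣≡∑ (inside ∷ p) = cong suc (∣p∣≡∑ p)
∣p∣≡∑ (outside ∷ p) = ∣p∣≡∑ p

injection≤∣p∣ : ∀ {k n} (f : Fin k → Fin n) → Injective _≡_ _≡_ f →
  (p : Subset n) → (∀ i → f i ∈ p) → k ≤ ∣ p ∣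
injection≤∣p∣ f f-inj p f∈p = subst (_ ≤_) (sym (∣p∣≡∑ p))
  (injection≤∑ f f-inj _ (λ i → subst (λ b → 0 < 𝟙 b) (sym (dec-true (f i ∈? p) (f∈p i))) (s≤s z≤n)))

injection-escapes : ∀ {k n} (f : Fin k → Fin n) → Injective _≡_ _≡_ f →
  (p : Subset n) → ∣ p ∣ < k → ∃ λ i → f i ∉ p
injection-escapes {k} f f-inj p ∣p∣<k =
  ¬∀⟶∃¬ k (λ i → f i ∈ p) (λ i → f i ∈? p) (λ f∈p → <⇒≱ ∣p∣<k (injection≤∣p∣ f f-inj p f∈p))

x∈p─q⇒x∉q : ∀ {n} (p q : Subset n) {x} → x ∈ p ─ q → x ∉ q
x∈p─q⇒x∉q (_ ∷ p) (outside ∷ q) Vec.here ()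
x∈p─q⇒x∉q (_ ∷ p) (_ ∷ q) (Vec.there x∈p─q) (Vec.there x∈q) = x∈p─q⇒x∉q p q x∈p─q x∈q

support : ∀ {n} → (Fin n → ℕ) → Subset n
support g = Vec.tabulate (λ i → does (0 <? g i))

∈support⁺ : ∀ {n} {g : Fin n → ℕ} {i} → 0 < g i → i ∈ support g
∈support⁺ {g = g} {i} g[i]>0 =
  lookup⇒[]= i (support g) (trans (lookup∘tabulate _ i) (dec-true (0 <? g i) g[i]>0))

∈support⁻ : ∀ {n} {g : Fin n → ℕ} {i} → i ∈ support g → 0 < g i
∈support⁻ {g = g} {i} i∈supp with 0 <? g i
... | yes g[i]>0 = g[i]>0
... | no g[i]≯0 = contradiction
  (trans (sym (dec-false (0 <? g i) g[i]≯0)) (trans (sym (lookup∘tabulate _ i)) ([]=⇒lookup i∈supp)))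
  λ ()

∣support∣<∑ : ∀ {n} (g : Fin n → ℕ) a → 1 < g a → ∣ support g ∣ < ∑ g
∣support∣<∑ g a g[a]>1 = subst (_< ∑ g) (sym (∣p∣≡∑ (support g)))
  (∑-mono-< {g = g} (λ i → 𝟙≤ (i ∈? support g) (∈support⁻ {g = g})) a (𝟙< (a ∈? support g)))
  where
  𝟙≤ : ∀ {P : Set} (P? : Dec P) {k} → (P → 0 < k) → 𝟙 (does P?) ≤ k
  𝟙≤ (yes p) P⇒k>0 = P⇒k>0 p
  𝟙≤ (no _) _ = z≤n
  𝟙< : ∀ {P : Set} (P? : Dec P) → 𝟙 (does P?) < g a
  𝟙< (yes _) = g[a]>1
  𝟙< (no _) = ≤-trans (s≤s z≤n) g[a]>1

Adj-sym : ∀ {n} (G : Graph n) {u v} → Adj G u v → Adj G v u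
Adj-sym G {u} {v} u~v = trans (Graph.sym G v u) u~v

Reach-head : ∀ {n} {G : Graph n} {P : Fin n → Set} {u v} → Reach G P u v → P u
Reach-head (here Pu) = Pu
Reach-head (step Pu _ _) = Pu

exit-edge : ∀ {n} {G : Graph n} {P Q : Fin n → Set} → Decidable Q → ∀ {a z} →
  Reach G P a z → Q a → ¬ Q z → ∃₂ λ x y → P x × P y × Q x × ¬ Q y × Adj G x y
exit-edge Q? (here _) Qa ¬Qz = contradiction Qa ¬Qz
exit-edge Q? (step {w = w} Pa a~w walk) Qa ¬Qz with Q? w
... | yes Qw = exit-edge Q? walk Qw ¬Qz
... | no ¬Qw = _ , w , Pa , Reach-head walk , Qa , ¬Qw , a~w

if-then-countFin : ∀ {n} b (p : Fin n → Bool) →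
  (if b then countFin p else 0) ≡ ∑[ v < n ] 𝟙 (if b then p v else false)
if-then-countFin true p = sum-map-allFin (𝟙 ∘ p)
if-then-countFin {n} false p = sym (sum-replicate-zero n)

isEdgeBetween : ∀ {n} → Graph n → Subset n → Subset n → Fin n → Fin n → Bool
isEdgeBetween G S T u v = if does (u ∈? S) then (if does (v ∈? T) then adj G u v else false) else false

isEdgeBetween-swap : ∀ {n} (G : Graph n) (S T : Subset n) u v →
  isEdgeBetween G S T u v ≡ isEdgeBetween G T S v u
isEdgeBetween-swap G S T u v = trans (if-swap-then (does (u ∈? S)) (does (v ∈? T)))
  (cong (λ e → if does (v ∈? T) then (if does (u ∈? S) then e else false) else false) (Graph.sym G u v))

numEdgesBetween≡∑∑ : ∀ {n} (G : Graph n) (S T : Subset n) →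
  numEdgesBetween G S T ≡ ∑[ u < n ] ∑[ v < n ] 𝟙 (isEdgeBetween G S T u v)
numEdgesBetween≡∑∑ {n} G S T =
  trans (sum-map-allFin {n} (λ u → if does (u ∈? S) then countFin (T-neighbour u) else 0))
        (sum-cong-≗ λ u → if-then-countFin (does (u ∈? S)) (T-neighbour u))
  where
  T-neighbour : Fin n → Fin n → Bool
  T-neighbour u v = if does (v ∈? T) then adj G u v else false

numEdgesBetween-comm : ∀ {n} (G : Graph n) (S T : Subset n) →
  numEdgesBetween G S T ≡ numEdgesBetween G T S
numEdgesBetween-comm {n} G S T = begin
  numEdgesBetween G S T                               ≡⟨ numEdgesBetween≡∑∑ G S T ⟩
  ∑[ u < n ] ∑[ v < n ] 𝟙 (isEdgeBetween G S T u v)   ≡⟨ ∑-comm (λ u v → 𝟙 (isEdgeBetween G S T u v)) ⟩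
  ∑[ v < n ] ∑[ u < n ] 𝟙 (isEdgeBetween G S T u v)   ≡⟨ sum-cong-≗ (λ v → sum-cong-≗ λ u →
                                                           cong 𝟙 (isEdgeBetween-swap G S T u v)) ⟩
  ∑[ v < n ] ∑[ u < n ] 𝟙 (isEdgeBetween G T S v u)   ≡⟨ sym (numEdgesBetween≡∑∑ G T S) ⟩
  numEdgesBetween G T S                               ∎
  where open ≡-Reasoning

separatorSize-comm : ∀ {n} (G : Graph n) (A B : Subset n) →
  separatorSize G A B ≡ separatorSize G B A
separatorSize-comm G A B = cong₂ _+_ (cong ∣_∣ (∩-comm A B)) (numEdgesBetween-comm G (A ─ B) (B ─ A))

module SeparatorCover {n} (G : Graph n) (A B : Subset n) where

  across : Fin n → Fin n → Bool
  across w v = if does (v ∈? B ─ A) then adj G w v else false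

  degreeAcross : Fin n → ℕ
  degreeAcross w = countFin (across w)

  across>0 : ∀ {w v} → v ∈ B ─ A → Adj G w v → 0 < 𝟙 (across w v)
  across>0 {w} {v} v∈B─A w~v rewrite dec-true (v ∈? B ─ A) v∈B─A | w~v = s≤s z≤n

  -- Each vertex of A ∩ B is charged once and each separator edge is charged to its end
  -- in A ∖ B, so the weights add up to the separator size; `cover` is the set X of the
  -- proof sketch.
  edgeWeight : Fin n → ℕ
  edgeWeight w = if does (w ∈? A ─ B) then degreeAcross w else 0

  weight : Fin n → ℕ
  weight w = 𝟙 (does (w ∈? A ∩ B)) + edgeWeight w

  ∑weight≡separatorSize : ∑ weight ≡ separatorSize G A B
  ∑weight≡separatorSize = trans (∑-distrib-+ (λ w → 𝟙 (does (w ∈? A ∩ B))) edgeWeight)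
    (cong₂ _+_ (sym (∣p∣≡∑ (A ∩ B))) (sym (sum-map-allFin edgeWeight)))

  cover : Subset n
  cover = support weight

  degreeAcross≤weight : ∀ {w} → w ∈ A ─ B → degreeAcross w ≤ weight w
  degreeAcross≤weight {w} w∈A─B rewrite dec-true (w ∈? A ─ B) w∈A─B = m≤n+m _ _

  degreeAcross>0 : ∀ {w v} → v ∈ B ─ A → Adj G w v → 0 < degreeAcross w
  degreeAcross>0 {w} {v} v∈B─A w~v =
    subst (0 <_) (sym (sum-map-allFin (𝟙 ∘ across w))) (<-≤-trans (across>0 v∈B─A w~v) (≤-∑ _ v))

  degreeAcross>1 : ∀ {w v v′} → v ≢ v′ → v ∈ B ─ A → v′ ∈ B ─ A → Adj G w v → Adj G w v′ →
    1 < degreeAcross w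
  degreeAcross>1 {w} v≢v′ v∈B─A v′∈B─A w~v w~v′ = subst (1 <_) (sym (sum-map-allFin (𝟙 ∘ across w)))
    (two≤∑ _ v≢v′ (across>0 v∈B─A w~v) (across>0 v′∈B─A w~v′))

  A∩B⊆cover : ∀ {w} → w ∈ A ∩ B → w ∈ cover
  A∩B⊆cover {w} w∈A∩B = ∈support⁺ {g = weight} 0<weight
    where
    0<weight : 0 < weight w
    0<weight rewrite dec-true (w ∈? A ∩ B) w∈A∩B = s≤s z≤n

  across⊆cover : ∀ {w v} → w ∈ A ─ B → v ∈ B ─ A → Adj G w v → w ∈ cover
  across⊆cover w∈A─B v∈B─A w~v =
    ∈support⁺ {g = weight} (<-≤-trans (degreeAcross>0 v∈B─A w~v) (degreeAcross≤weight w∈A─B))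

  cover⊆A : ∀ {w} → w ∈ cover → w ∈ A
  cover⊆A {w} w∈cover with w ∈? A
  ... | yes w∈A = w∈A
  ... | no w∉A = contradiction (∈support⁻ {g = weight} w∈cover) weight≯0
    where
    weight≯0 : ¬ (0 < weight w)
    weight≯0 rewrite dec-false (w ∈? A ∩ B) (w∉A ∘ proj₁ ∘ x∈p∩q⁻ A B)
                   | dec-false (w ∈? A ─ B) (w∉A ∘ p─q⊆p A B) = λ ()

  ∣cover∣<3 : separatorSize G A B ≡ 3 → ∀ {u} → u ∈ A ─ B → 1 < degreeAcross u → ∣ cover ∣ < 3
  ∣cover∣<3 sep {u} u∈A─B degree>1 = subst (∣ cover ∣ <_) (trans ∑weight≡separatorSize sep)
    (∣support∣<∑ weight u (<-≤-trans degree>1 (degreeAcross≤weight u∈A─B)))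

  A─B-leaves-through-cover : A ∪ B ≡ ⊤ → ∀ {x y} → x ∈ A ─ B → y ∉ A ─ B → Adj G x y →
    x ∈ cover ⊎ y ∈ cover
  A─B-leaves-through-cover A∪B≡⊤ {x} {y} x∈A─B y∉A─B x~y with y ∈? A | y ∈? B
  ... | yes y∈A | yes y∈B = inj₂ (A∩B⊆cover (x∈p∩q⁺ (y∈A , y∈B)))
  ... | yes y∈A | no y∉B = contradiction (x∈p∧x∉q⇒x∈p─q y∈A y∉B) y∉A─B
  ... | no y∉A | yes y∈B = inj₁ (across⊆cover x∈A─B (x∈p∧x∉q⇒x∈p─q y∈B y∉A) x~y)
  ... | no y∉A | no y∉B with x∈p∪q⁻ A B (subst (y ∈_) (sym A∪B≡⊤) ∈⊤)
  ...   | inj₁ y∈A = contradiction y∈A y∉A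
  ...   | inj₂ y∈B = contradiction y∈B y∉B

  neighbourAcross-unique : KConnected 3 G → A ∪ B ≡ ⊤ → separatorSize G A B ≡ 3 → HasCycleIn G A →
    ∀ {u v v′} → u ∈ A ─ B → v ∈ B ─ A → v′ ∈ B ─ A → Adj G u v → Adj G u v′ → v ≡ v′
  neighbourAcross-unique (_ , connected) A∪B≡⊤ sep (m , c , c-injective , c⊆A , _)
                         {u} {v} {v′} u∈A─B v∈B─A v′∈B─A u~v u~v′ with v ≟ v′
  ... | yes v≡v′ = v≡v′
  ... | no v≢v′ = ⊥-elim (no-exit (exit-edge (_∈? A ─ B) walk w∈A─B (v∉A ∘ p─q⊆p A B)))
    where
    v∉A : v ∉ A
    v∉A = x∈p─q⇒x∉q B A v∈B─A
    ∣cover∣<3′ : ∣ cover ∣ < 3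
    ∣cover∣<3′ = ∣cover∣<3 sep u∈A─B (degreeAcross>1 v≢v′ v∈B─A v′∈B─A u~v u~v′)
    escape : ∃ λ i → c i ∉ cover
    escape = injection-escapes c c-injective cover (<-≤-trans ∣cover∣<3′ (m≤m+n 3 m))
    w : Fin n
    w = c (proj₁ escape)
    w∈A : w ∈ A
    w∈A = c⊆A (proj₁ escape)
    w∈A─B : w ∈ A ─ B
    w∈A─B = x∈p∧x∉q⇒x∈p─q w∈A (λ w∈B → proj₂ escape (A∩B⊆cover (x∈p∩q⁺ (w∈A , w∈B))))
    walk : Reach G (_∉ cover) w v
    walk = connected cover ∣cover∣<3′ w v (proj₂ escape) (v∉A ∘ cover⊆A)
    no-exit : ¬ (∃₂ λ x y → x ∉ cover × y ∉ cover × x ∈ A ─ B × y ∉ A ─ B × Adj G x y)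
    no-exit (x , y , x∉cover , y∉cover , x∈A─B , y∉A─B , x~y) =
      [ x∉cover , y∉cover ] (A─B-leaves-through-cover A∪B≡⊤ x∈A─B y∉A─B x~y)

mainTheorem5 : ∀ {n} (G : Graph n) (A B : Subset n) →
    KConnected 3 G → IsMixed3Separation G A B →
    HasCycleIn G A → HasCycleIn G B →
    IsMatchingBetween G (A ─ B) (B ─ A)
mainTheorem5 G A B 3-conn (A∪B≡⊤ , _ , _ , sep) cycleA _ u v u′ v′ u∈ v∈ u~v _ v′∈ u′~v′ (inj₁ refl) =
  refl , SeparatorCover.neighbourAcross-unique G A B 3-conn A∪B≡⊤ sep cycleA u∈ v∈ v′∈ u~v u′~v′
mainTheorem5 G A B 3-conn (A∪B≡⊤ , _ , _ , sep) _ cycleB u v u′ v′ u∈ v∈ u~v u′∈ _ u′~v′ (inj₂ refl) =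
  SeparatorCover.neighbourAcross-unique G B A 3-conn B∪A≡⊤ sep′ cycleB v∈ u∈ u′∈
    (Adj-sym G u~v) (Adj-sym G u′~v′) , refl
  where
  B∪A≡⊤ : B ∪ A ≡ ⊤
  B∪A≡⊤ = trans (∪-comm B A) A∪B≡⊤
  sep′ : separatorSize G B A ≡ 3
  sep′ = trans (separatorSize-comm G B A) sep
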